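{- For each $n_1\geq n_2\geq n_3\geq 2$ it holds \[\mathrm{qc}(n_1, n_2, n_3) \geq \frac{1}{2} \big( n_2 - 1 \big) n_3 \left( \log_2 \frac{n_1 - 1}{n_2 - 1} + 1 \right).\]
   Context: Search game on the grid $S_1\times\cdots\times S_d$ with $S_i=\{0,\ldots,n_i-1\}$: Adversary fixes a target $t$; Algorithm queries a point $q$; if $q\neq t$, Adversary answers for every coordinate $i$ one of $t_i<q_i$ or $t_i>q_i$, at least one of these $d$ inequalities being true, and Algorithm does not learn which one. $\mathrm{qc}(n_1,\ldots,n_d)$ denotes the minimum number of queries that guarantees finding the target (the query complexity). Here $d=3$. -}

module Defs where

open import Data.Nat using (ℕ; zero; suc; _<_)
open import Data.Fin using (Fin; toℕ)
open import Data.Bool using (Bool; true; false)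
open import Data.Product using (_×_; _,_; Σ)
open import Data.Sum using (_⊎_)
open import Data.Empty using (⊥)
open import Relation.Binary.PropositionalEquality using (_≡_)

Point : ℕ → ℕ → ℕ → Set
Point n₁ n₂ n₃ = Fin n₁ × Fin n₂ × Fin n₃

-- An answer: for each coordinate i, one of the two inequalities.
-- true  means "tᵢ < qᵢ",  false means "tᵢ > qᵢ".
Answer : Set
Answer = Bool × Bool × Bool

Holds : ∀ {m} → Bool → (x y : Fin m) → Set
Holds true  x y = toℕ x < toℕ y
Holds false x y = toℕ y < toℕ x

Legal : ∀ {n₁ n₂ n₃} → (t q : Point n₁ n₂ n₃) → Answer → Set
Legal (t₁ , t₂ , t₃) (q₁ , q₂ , q₃) (a₁ , a₂ , a₃) =
  Holds a₁ t₁ q₁ ⊎ Holds a₂ t₂ q₂ ⊎ Holds a₃ t₃ q₃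

-- A deterministic adaptive algorithm: a decision tree. At each node it
-- queries a point and continues according to the answer, or gives up.
data Algorithm (n₁ n₂ n₃ : ℕ) : Set where
  giveUp : Algorithm n₁ n₂ n₃
  query  : Point n₁ n₂ n₃ → (Answer → Algorithm n₁ n₂ n₃) → Algorithm n₁ n₂ n₃

FindsWithin : ∀ {n₁ n₂ n₃} → ℕ → Algorithm n₁ n₂ n₃ → Point n₁ n₂ n₃ → Set
FindsWithin zero    A           t = ⊥
FindsWithin (suc k) giveUp      t = ⊥
FindsWithin (suc k) (query q f) t =
  (q ≡ t) ⊎ (∀ a → Legal t q a → FindsWithin k (f a) t)

-- k queries suffice to guarantee finding the target (i.e. qc ≤ k).
Solvable : ℕ → ℕ → ℕ → ℕ → Set
Solvable n₁ n₂ n₃ k =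
  Σ (Algorithm n₁ n₂ n₃) λ A → ∀ (t : Point n₁ n₂ n₃) → FindsWithin k A t

-- Call the targets with given (t₂, t₃) a fiber. The adversary keeps an interval of possible t₁ for
-- every fiber and answers a query (q₁, c) either "t₁ > q₁, t₂ < c₂, t₃ < c₃" or the reverse. If
-- every fiber strictly above c in the product order only ever held values > q₁, the first answer
-- is legal for all remaining targets once the interval of c is cut to values > q₁; symmetrically
-- for the second. Placing the initial intervals increasingly along the diagonals i + j makes one of
-- the answers available with the larger part of c's interval kept, so ∏ (1 + interval length) at
-- most halves per query and is 1 when no target is left: 2^k ≥ (ℓ + 2)^((n₂-1) n₃) for intervals
-- of length ℓ + 1. Choosing ℓ + 1 > (n₁-1) / 2(n₂-1) gives the bound, as 2(n₁-1) ≤ (ℓ + 2)² (n₂-1).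
module Submission where

open import Defs
open import Data.Nat using (ℕ; zero; suc; _≤_; _<_; _*_; _+_; _∸_; _^_; _⊓_; _⊔_; z≤n; s≤s; z<s; ⌊_/2⌋; _≤?_; NonZero; >-nonZero⁻¹)
open import Data.Nat.Properties
open import Data.Nat.DivMod using (_/_; _%_; m/n*n≤m; m≡m%n+[m/n]*n; m%n<n)
open import Data.Nat.Tactic.RingSolver using (solve-∀)
open import Algebra.Properties.CommutativeSemigroup *-commutativeSemigroup using (x∙yz≈y∙xz)
open import Data.Fin using (Fin; zero; suc; toℕ; fromℕ<)
open import Data.Fin.Properties using (toℕ-injective; toℕ<n; toℕ-fromℕ<) renaming (_≟_ to _≟ᶠ_; suc-injective to Fin-suc-injective)
open import Data.Bool using (true; false)
open import Data.Product using (_×_; _,_; proj₁; proj₂; ∃-syntax)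
open import Data.Product.Properties using (≡-dec)
open import Data.Sum using (_⊎_; inj₁; inj₂)
open import Data.Empty using (⊥-elim)
open import Function using (_∘_)
open import Relation.Nullary using (yes; no; ¬_)
open import Relation.Binary using (tri<; tri≈; tri>)
open import Relation.Binary.PropositionalEquality

∏ : (n : ℕ) → (Fin n → ℕ) → ℕ
∏ zero    f = 1
∏ (suc n) f = f zero * ∏ n (f ∘ suc)

∏-mono-≤ : ∀ n {f g : Fin n → ℕ} → (∀ x → f x ≤ g x) → ∏ n f ≤ ∏ n g
∏-mono-≤ zero    f≤g = ≤-refl
∏-mono-≤ (suc n) f≤g = *-mono-≤ (f≤g zero) (∏-mono-≤ n (f≤g ∘ suc))

∏-const : ∀ n {f : Fin n → ℕ} c → (∀ x → f x ≡ c) → ∏ n f ≡ c ^ n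
∏-const zero    c f≡c = refl
∏-const (suc n) c f≡c = cong₂ _*_ (f≡c zero) (∏-const n c (f≡c ∘ suc))

∏-mono-≤-except : ∀ n {f g : Fin n → ℕ} (x₀ : Fin n) K → f x₀ ≤ K * g x₀ →
  (∀ x → x ≢ x₀ → f x ≤ g x) → ∏ n f ≤ K * ∏ n g
∏-mono-≤-except (suc n) {f} {g} zero K f≤Kg f≤g = begin
  f zero * ∏ n (f ∘ suc)     ≤⟨ *-mono-≤ f≤Kg (∏-mono-≤ n (λ x → f≤g (suc x) λ ())) ⟩
  K * g zero * ∏ n (g ∘ suc) ≡⟨ *-assoc K _ _ ⟩
  K * ∏ (suc n) g            ∎
  where open ≤-Reasoning
∏-mono-≤-except (suc n) {f} {g} (suc x₀) K f≤Kg f≤g = begin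
  f zero * ∏ n (f ∘ suc)       ≤⟨ *-mono-≤ (f≤g zero λ ())
                                    (∏-mono-≤-except n x₀ K f≤Kg λ x x≢x₀ → f≤g (suc x) (x≢x₀ ∘ Fin-suc-injective)) ⟩
  g zero * (K * ∏ n (g ∘ suc)) ≡⟨ x∙yz≈y∙xz (g zero) K _ ⟩
  K * ∏ (suc n) g              ∎
  where open ≤-Reasoning

^-distrib-* : ∀ a b m → (a * b) ^ m ≡ a ^ m * b ^ m
^-distrib-* a b zero    = refl
^-distrib-* a b (suc m) = trans (cong (a * b *_) (^-distrib-* a b m)) ([m*n]*[o*p]≡[m*o]*[n*p] a b _ _)

Fiber : ℕ → ℕ → Set
Fiber n₂ n₃ = Fin n₂ × Fin n₃

_≺_ : ∀ {n₂ n₃} → Fiber n₂ n₃ → Fiber n₂ n₃ → Set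
(i , j) ≺ (i′ , j′) = toℕ i ≤ toℕ i′ × toℕ j ≤ toℕ j′ × (toℕ i < toℕ i′ ⊎ toℕ j < toℕ j′)

FiberComparison : ∀ {n₂ n₃} → Fiber n₂ n₃ → Fiber n₂ n₃ → Set
FiberComparison c t = toℕ (proj₁ t) < toℕ (proj₁ c) ⊎ toℕ (proj₂ t) < toℕ (proj₂ c) ⊎ t ≡ c ⊎ c ≺ t

fiber-cases : ∀ {n₂ n₃} (c t : Fiber n₂ n₃) → FiberComparison c t
fiber-cases (c₂ , c₃) (t₂ , t₃) with <-cmp (toℕ t₂) (toℕ c₂) | <-cmp (toℕ t₃) (toℕ c₃)
... | tri< t₂<c₂ _ _ | _                = inj₁ t₂<c₂
... | _              | tri< t₃<c₃ _ _   = inj₂ (inj₁ t₃<c₃)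
... | tri≈ _ e₂ _    | tri≈ _ e₃ _      = inj₂ (inj₂ (inj₁ (cong₂ _,_ (toℕ-injective e₂) (toℕ-injective e₃))))
... | tri≈ _ e₂ _    | tri> _ _ c₃<t₃   = inj₂ (inj₂ (inj₂ (≤-reflexive (sym e₂) , <⇒≤ c₃<t₃ , inj₂ c₃<t₃)))
... | tri> _ _ c₂<t₂ | tri≈ _ e₃ _      = inj₂ (inj₂ (inj₂ (<⇒≤ c₂<t₂ , ≤-reflexive (sym e₃) , inj₁ c₂<t₂)))
... | tri> _ _ c₂<t₂ | tri> _ _ c₃<t₃   = inj₂ (inj₂ (inj₂ (<⇒≤ c₂<t₂ , <⇒≤ c₃<t₃ , inj₁ c₂<t₂)))

Bounds : ℕ → ℕ → Set
Bounds n₂ n₃ = Fiber n₂ n₃ → ℕ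

module _ {n₂ n₃ : ℕ} where

  _[_≔_] : Bounds n₂ n₃ → Fiber n₂ n₃ → ℕ → Bounds n₂ n₃
  (f [ c ≔ v ]) c′ with ≡-dec _≟ᶠ_ _≟ᶠ_ c′ c
  ... | yes _ = v
  ... | no  _ = f c′

  update-at : ∀ f c v → (f [ c ≔ v ]) c ≡ v
  update-at f c v with ≡-dec _≟ᶠ_ _≟ᶠ_ c c
  ... | yes _   = refl
  ... | no  c≢c = ⊥-elim (c≢c refl)

  update-off : ∀ f {c c′} v → c′ ≢ c → (f [ c ≔ v ]) c′ ≡ f c′
  update-off f {c} {c′} v c′≢c with ≡-dec _≟ᶠ_ _≟ᶠ_ c′ c
  ... | yes c′≡c = ⊥-elim (c′≢c c′≡c)
  ... | no  _    = refl

  ≤-update : ∀ f c {v} → f c ≤ v → ∀ c′ → f c′ ≤ (f [ c ≔ v ]) c′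
  ≤-update f c fc≤v c′ with ≡-dec _≟ᶠ_ _≟ᶠ_ c′ c
  ... | yes refl = fc≤v
  ... | no  _    = ≤-refl

  update-≤ : ∀ f c {v} → v ≤ f c → ∀ c′ → (f [ c ≔ v ]) c′ ≤ f c′
  update-≤ f c v≤fc c′ with ≡-dec _≟ᶠ_ _≟ᶠ_ c′ c
  ... | yes refl = v≤fc
  ... | no  _    = ≤-refl

  Inside : Bounds n₂ n₃ → Bounds n₂ n₃ → Fiber n₂ n₃ → ℕ → Set
  Inside l h c x = l c ≤ x × x < h c

  Φ : Bounds n₂ n₃ → Bounds n₂ n₃ → ℕ
  Φ l h = ∏ n₂ λ i → ∏ n₃ λ j → suc (h (i , j) ∸ l (i , j))

  Φ-cut : ∀ {l h l′ h′} c → (∀ c′ → c′ ≢ c → l′ c′ ≡ l c′ × h′ c′ ≡ h c′) →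
    suc (h c ∸ l c) ≤ 2 * suc (h′ c ∸ l′ c) → Φ l h ≤ 2 * Φ l′ h′
  Φ-cut {l} {h} {l′} {h′} (a , b) same cut =
    ∏-mono-≤-except n₂ a 2 (∏-mono-≤-except n₃ b 2 cut λ j j≢b → unchanged (a , j) (j≢b ∘ cong proj₂))
      λ i i≢a → ∏-mono-≤ n₃ λ j → unchanged (i , j) (i≢a ∘ cong proj₁)
    where
    unchanged : ∀ c′ → c′ ≢ (a , b) → suc (h c′ ∸ l c′) ≤ suc (h′ c′ ∸ l′ c′)
    unchanged c′ c′≢c with same c′ c′≢c
    ... | l′≡l , h′≡h = ≤-reflexive (sym (cong₂ (λ u v → suc (v ∸ u)) l′≡l h′≡h))

  module _ (lo hi : Bounds n₂ n₃) where

    -- The answer "t₁ > Q, t₂ < c₂, t₃ < c₃" to the query (Q, c) is harmless outside fiber c.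
    ClearAbove ClearBelow : Fiber n₂ n₃ → ℕ → Set
    ClearAbove c Q = ∀ c′ → c ≺ c′ → ∀ x → Inside lo hi c′ x → Q < x
    ClearBelow c Q = ∀ c′ → c′ ≺ c → ∀ x → Inside lo hi c′ x → x < Q

    -- In the last two cases the available answer removes from fiber c at most the value Q.
    Admissible : Fiber n₂ n₃ → ℕ → Set
    Admissible c Q = (ClearAbove c Q × ClearBelow c Q)
                   ⊎ (ClearAbove c Q × Q ≤ lo c)
                   ⊎ (ClearBelow c Q × hi c ≤ suc Q)

-- [l, h) is split into its part above q, its part below q, and q itself.
interval-split : ∀ l q h → h ∸ l ≤ suc ((h ∸ (l ⊔ suc q)) + ((h ⊓ q) ∸ l))
interval-split zero    q       zero    = z≤n
interval-split (suc l) q       zero    = z≤n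
interval-split zero    zero    (suc h) = s≤s (m≤m+n h 0)
interval-split zero    (suc q) (suc h) =
  s≤s (≤-trans (interval-split zero q h) (≤-reflexive (sym (+-suc (h ∸ suc q) (h ⊓ q)))))
interval-split (suc l) zero    (suc h) rewrite ⊔-identityʳ l = ≤-trans (n≤1+n _) (s≤s (m≤m+n _ 0))
interval-split (suc l) (suc q) (suc h) = interval-split l q h

keep-larger-part : ∀ {s a b} → s ≤ suc (a + b) → b ≤ a → suc s ≤ 2 * suc a
keep-larger-part {s} {a} s≤ b≤a = ≤-trans (s≤s (≤-trans s≤ (s≤s (+-monoʳ-≤ a b≤a)))) (≤-reflexive (double a))
  where
  double : ∀ a → 2 + (a + a) ≡ 2 * (1 + a)
  double = solve-∀

Holds-irrefl : ∀ {m} b (x : Fin m) → ¬ Holds b x x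
Holds-irrefl true  x = <-irrefl refl
Holds-irrefl false x = <-irrefl refl

¬Legal-self : ∀ {n₁ n₂ n₃} (t : Point n₁ n₂ n₃) a → ¬ Legal t t a
¬Legal-self t (a₁ , a₂ , a₃) (inj₁ h)        = Holds-irrefl a₁ _ h
¬Legal-self t (a₁ , a₂ , a₃) (inj₂ (inj₁ h)) = Holds-irrefl a₂ _ h
¬Legal-self t (a₁ , a₂ , a₃) (inj₂ (inj₂ h)) = Holds-irrefl a₃ _ h

-- The adversary strategy

module Adversary {n₁ n₂ n₃ : ℕ} (lo hi : Bounds n₂ n₃) where

  Candidate : Bounds n₂ n₃ → Bounds n₂ n₃ → Point n₁ n₂ n₃ → Set
  Candidate l h (t₁ , c) = Inside l h c (toℕ t₁)

  Within : Bounds n₂ n₃ → Bounds n₂ n₃ → Set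
  Within l h = ∀ c → lo c ≤ l c × h c ≤ hi c

  record Response (l h : Bounds n₂ n₃) (q : Point n₁ n₂ n₃) : Set where
    field
      answer    : Answer
      l′ h′     : Bounds n₂ n₃
      within′   : Within l′ h′
      inherited : ∀ t → Candidate l′ h′ t → Candidate l h t × Legal t q answer
      halving   : Φ l h ≤ 2 * Φ l′ h′

  module _ {l h : Bounds n₂ n₃} (within : Within l h) (q₁ : Fin n₁) (c : Fiber n₂ n₃) where

    private
      Q = toℕ q₁

    sizeAbove sizeBelow : ℕ
    sizeAbove = h c ∸ (l c ⊔ suc Q)
    sizeBelow = (h c ⊓ Q) ∸ l c

    sizeBelow≡0 : Q ≤ lo c → sizeBelow ≡ 0
    sizeBelow≡0 Q≤lo = m≤n⇒m∸n≡0 (≤-trans (m⊓n≤n (h c) Q) (≤-trans Q≤lo (proj₁ (within c))))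

    sizeAbove≡0 : hi c ≤ suc Q → sizeAbove ≡ 0
    sizeAbove≡0 hi≤1+Q = m≤n⇒m∸n≡0 (≤-trans (proj₂ (within c)) (≤-trans hi≤1+Q (m≤n⊔m (l c) (suc Q))))

    respondAbove : ClearAbove lo hi c Q → sizeBelow ≤ sizeAbove → Response l h (q₁ , c)
    respondAbove clear below≤above = record
      { answer    = false , true , true
      ; l′        = l′
      ; h′        = h
      ; within′   = λ c′ → ≤-trans (proj₁ (within c′)) (l≤l′ c′) , proj₂ (within c′)
      ; inherited = λ { (t₁ , t) (l′≤t₁ , t₁<h) →
                        (≤-trans (l≤l′ t) l′≤t₁ , t₁<h) , legal t₁ t l′≤t₁ t₁<h (fiber-cases c t) }
      ; halving   = Φ-cut {l′ = l′} {h′ = h} c (λ c′ c′≢c → update-off l _ c′≢c , refl)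
                      (subst (λ v → suc (h c ∸ l c) ≤ 2 * suc (h c ∸ v)) (sym (update-at l c _))
                        (keep-larger-part (interval-split (l c) Q (h c)) below≤above))
      }
      where
      l′ = l [ c ≔ l c ⊔ suc Q ]
      l≤l′ = ≤-update l c (m≤m⊔n (l c) (suc Q))
      legal : ∀ t₁ t → l′ t ≤ toℕ t₁ → toℕ t₁ < h t → FiberComparison c t →
        Legal (t₁ , t) (q₁ , c) (false , true , true)
      legal t₁ t l′≤t₁ t₁<h (inj₁ t₂<c₂)        = inj₂ (inj₁ t₂<c₂)
      legal t₁ t l′≤t₁ t₁<h (inj₂ (inj₁ t₃<c₃)) = inj₂ (inj₂ t₃<c₃)
      legal t₁ t l′≤t₁ t₁<h (inj₂ (inj₂ (inj₁ t≡c))) =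
        inj₁ (≤-trans (m≤n⊔m (l c) (suc Q))
               (subst (_≤ toℕ t₁) (update-at l c _) (subst (λ c′ → l′ c′ ≤ toℕ t₁) t≡c l′≤t₁)))
      legal t₁ t l′≤t₁ t₁<h (inj₂ (inj₂ (inj₂ c≺t))) =
        inj₁ (clear t c≺t (toℕ t₁)
               (≤-trans (proj₁ (within t)) (≤-trans (l≤l′ t) l′≤t₁) , <-≤-trans t₁<h (proj₂ (within t))))

    respondBelow : ClearBelow lo hi c Q → sizeAbove ≤ sizeBelow → Response l h (q₁ , c)
    respondBelow clear above≤below = record
      { answer    = true , false , false
      ; l′        = l
      ; h′        = h′
      ; within′   = λ c′ → proj₁ (within c′) , ≤-trans (h′≤h c′) (proj₂ (within c′))
      ; inherited = λ { (t₁ , t) (l≤t₁ , t₁<h′) →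
                        (l≤t₁ , <-≤-trans t₁<h′ (h′≤h t)) , legal t₁ t l≤t₁ t₁<h′ (fiber-cases t c) }
      ; halving   = Φ-cut {l′ = l} {h′ = h′} c (λ c′ c′≢c → refl , update-off h _ c′≢c)
                      (subst (λ v → suc (h c ∸ l c) ≤ 2 * suc (v ∸ l c)) (sym (update-at h c _))
                        (keep-larger-part (subst (λ s → h c ∸ l c ≤ suc s) (+-comm sizeAbove sizeBelow)
                          (interval-split (l c) Q (h c))) above≤below))
      }
      where
      h′ = h [ c ≔ h c ⊓ Q ]
      h′≤h = update-≤ h c (m⊓n≤m (h c) Q)
      legal : ∀ t₁ t → l t ≤ toℕ t₁ → toℕ t₁ < h′ t → FiberComparison t c →
        Legal (t₁ , t) (q₁ , c) (true , false , false)
      legal t₁ t l≤t₁ t₁<h′ (inj₁ c₂<t₂)        = inj₂ (inj₁ c₂<t₂)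
      legal t₁ t l≤t₁ t₁<h′ (inj₂ (inj₁ c₃<t₃)) = inj₂ (inj₂ c₃<t₃)
      legal t₁ t l≤t₁ t₁<h′ (inj₂ (inj₂ (inj₁ c≡t))) =
        inj₁ (≤-trans (subst (toℕ t₁ <_) (update-at h c _) (subst (λ c′ → toℕ t₁ < h′ c′) (sym c≡t) t₁<h′))
                      (m⊓n≤n (h c) Q))
      legal t₁ t l≤t₁ t₁<h′ (inj₂ (inj₂ (inj₂ t≺c))) =
        inj₁ (clear t t≺c (toℕ t₁)
               (≤-trans (proj₁ (within t)) l≤t₁ , <-≤-trans t₁<h′ (≤-trans (h′≤h t) (proj₂ (within t)))))

    respond : Admissible lo hi c Q → Response l h (q₁ , c)
    respond (inj₁ (above , below)) with sizeBelow ≤? sizeAbove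
    ... | yes below≤above = respondAbove above below≤above
    ... | no  below≰above = respondBelow below (<⇒≤ (≰⇒> below≰above))
    respond (inj₂ (inj₁ (above , Q≤lo)))   = respondAbove above (subst (_≤ sizeAbove) (sym (sizeBelow≡0 Q≤lo)) z≤n)
    respond (inj₂ (inj₂ (below , hi≤1+Q))) = respondBelow below (subst (_≤ sizeBelow) (sym (sizeAbove≡0 hi≤1+Q)) z≤n)

  module _ (hi≤n₁ : ∀ c → hi c ≤ n₁) (admissible : ∀ c Q → Admissible lo hi c Q) where

    Φ≤1 : ∀ {l h} → Within l h → (∀ t → ¬ Candidate l h t) → Φ l h ≤ 1
    Φ≤1 {l} {h} within none = begin
      Φ l h                ≤⟨ ∏-mono-≤ n₂ (λ i → ∏-mono-≤ n₃ λ j → empty (i , j)) ⟩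
      ∏ n₂ (λ _ → ∏ n₃ λ _ → 1) ≡⟨ ∏-const n₂ _ (λ _ → trans (∏-const n₃ 1 λ _ → refl) (^-zeroˡ n₃)) ⟩
      1 ^ n₂               ≡⟨ ^-zeroˡ n₂ ⟩
      1                    ∎
      where
      open ≤-Reasoning
      empty : ∀ c → suc (h c ∸ l c) ≤ 1
      empty c with h c ≤? l c
      ... | yes h≤l = ≤-reflexive (cong suc (m≤n⇒m∸n≡0 h≤l))
      ... | no  h≰l = ⊥-elim (none (fromℕ< l<n₁ , c)
                        (≤-reflexive (sym (toℕ-fromℕ< l<n₁)) , subst (_< h c) (sym (toℕ-fromℕ< l<n₁)) (≰⇒> h≰l)))
        where
        l<n₁ : l c < n₁
        l<n₁ = <-≤-trans (≰⇒> h≰l) (≤-trans (proj₂ (within c)) (hi≤n₁ c))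

    Φ≤2^queries : ∀ k (A : Algorithm n₁ n₂ n₃) {l h} → Within l h →
      (∀ t → Candidate l h t → FindsWithin k A t) → Φ l h ≤ 2 ^ k
    Φ≤2^queries zero    A              within finds = Φ≤1 within finds
    Φ≤2^queries (suc k) giveUp         within finds = ≤-trans (Φ≤1 within finds) (m^n>0 2 (suc k))
    Φ≤2^queries (suc k) (query q next) within finds =
      ≤-trans halving (*-monoʳ-≤ 2 (Φ≤2^queries k (next answer) within′ finds′))
      where
      open Response (respond within (proj₁ q) (proj₂ q) (admissible (proj₂ q) (toℕ (proj₁ q))))
      finds′ : ∀ t → Candidate l′ h′ t → FindsWithin k (next answer) t
      finds′ t candidate with inherited t candidate
      ... | candidate₀ , legal with finds t candidate₀
      ...   | inj₁ q≡t  = ⊥-elim (¬Legal-self t answer (subst (λ q → Legal t q answer) q≡t legal))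
      ...   | inj₂ rest = rest answer legal

    Solvable⇒Φ≤2^k : ∀ k → Solvable n₁ n₂ n₃ k → Φ lo hi ≤ 2 ^ k
    Solvable⇒Φ≤2^k k (A , finds) = Φ≤2^queries k A (λ c → ≤-refl , ≤-refl) (λ t _ → finds t)

-- Diagonal layouts

LaterAbove : (ℕ → ℕ) → ℕ → ℕ → Set
LaterAbove pos d Q = ∀ d′ → d < d′ → Q < pos d′

EarlierBelow : ℕ → (ℕ → ℕ) → ℕ → ℕ → Set
EarlierBelow ℓ pos d Q = ∀ d′ → d′ < d → pos d′ + ℓ < Q

Separated : ℕ → (ℕ → ℕ) → ℕ → ℕ → Set
Separated ℓ pos d Q = (LaterAbove pos d Q × EarlierBelow ℓ pos d Q)
                    ⊎ (LaterAbove pos d Q × Q ≤ pos d)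
                    ⊎ (EarlierBelow ℓ pos d Q × pos d + ℓ ≤ Q)

-- Row 0 is left empty, so the other p × n₃ fibers lie on the 2p diagonals i + j < 2p (as n₃ ≤ p + 1).
module DiagonalLayout (p n₃ ℓ : ℕ) (pos : ℕ → ℕ) where

  lo hi : Bounds (suc p) n₃
  lo (zero  , j) = 0
  lo (suc i , j) = pos (toℕ i + toℕ j)
  hi (zero  , j) = 0
  hi (suc i , j) = pos (toℕ i + toℕ j) + suc ℓ

  diagonal-< : ∀ {i i′ : Fin p} {j j′ : Fin n₃} → (suc i , j) ≺ (suc i′ , j′) →
    toℕ i + toℕ j < toℕ i′ + toℕ j′
  diagonal-< (s≤s i≤i′ , j≤j′ , inj₁ (s≤s i<i′)) = +-mono-<-≤ i<i′ j≤j′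
  diagonal-< (s≤s i≤i′ , j≤j′ , inj₂ j<j′)       = +-mono-≤-< i≤i′ j<j′

  clearAbove : ∀ i j {Q} → LaterAbove pos (toℕ i + toℕ j) Q → ClearAbove lo hi (suc i , j) Q
  clearAbove i j later (zero   , j′) (() , _)
  clearAbove i j later (suc i′ , j′) c≺c′ x (pos≤x , _) = <-≤-trans (later _ (diagonal-< c≺c′)) pos≤x

  clearBelow : ∀ i j {Q} → EarlierBelow ℓ pos (toℕ i + toℕ j) Q → ClearBelow lo hi (suc i , j) Q
  clearBelow i j earlier (zero   , j′) c′≺c x (_ , ())
  clearBelow i j earlier (suc i′ , j′) c′≺c x (_ , x<hi) =
    ≤-<-trans (≤-pred (subst (x <_) (+-suc _ ℓ) x<hi)) (earlier _ (diagonal-< c′≺c))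

  clearBelow-row₀ : ∀ j Q → ClearBelow lo hi (zero , j) Q
  clearBelow-row₀ j Q (zero   , j′) c′≺c x (_ , ())
  clearBelow-row₀ j Q (suc i′ , j′) (() , _)

  admissible : (∀ d Q → Separated ℓ pos d Q) → ∀ c Q → Admissible lo hi c Q
  admissible separated (zero , j) Q = inj₂ (inj₂ (clearBelow-row₀ j Q , z≤n))
  admissible separated (suc i , j) Q with separated (toℕ i + toℕ j) Q
  ... | inj₁ (later , earlier)         = inj₁ (clearAbove i j later , clearBelow i j earlier)
  ... | inj₂ (inj₁ (later , Q≤pos))    = inj₂ (inj₁ (clearAbove i j later , Q≤pos))
  ... | inj₂ (inj₂ (earlier , pos+ℓ≤Q)) =
    inj₂ (inj₂ (clearBelow i j earlier , ≤-trans (≤-reflexive (+-suc _ ℓ)) (s≤s pos+ℓ≤Q)))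

  hi≤ : ∀ {n₁} → (∀ d → d < p + p → pos d + suc ℓ ≤ n₁) → n₃ ≤ suc p → ∀ c → hi c ≤ n₁
  hi≤ fits n₃≤1+p (zero  , j) = z≤n
  hi≤ fits n₃≤1+p (suc i , j) = fits _ (+-mono-<-≤ (toℕ<n i) (≤-pred (≤-trans (toℕ<n j) n₃≤1+p)))

  Φ-layout : Φ lo hi ≡ suc (suc ℓ) ^ (p * n₃)
  Φ-layout = begin
    ∏ n₃ (λ _ → 1) * ∏ p (λ i → ∏ n₃ λ j → suc (pos (toℕ i + toℕ j) + suc ℓ ∸ pos (toℕ i + toℕ j)))
      ≡⟨ cong₂ _*_ (∏-const n₃ 1 λ _ → refl)
           (∏-const p _ λ i → ∏-const n₃ _ λ j → cong suc (m+n∸m≡n (pos (toℕ i + toℕ j)) (suc ℓ))) ⟩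
    1 ^ n₃ * (suc (suc ℓ) ^ n₃) ^ p
      ≡⟨ cong₂ _*_ (^-zeroˡ n₃) (^-*-assoc (suc (suc ℓ)) n₃ p) ⟩
    1 * suc (suc ℓ) ^ (n₃ * p)
      ≡⟨ trans (*-identityˡ _) (cong (suc (suc ℓ) ^_) (*-comm n₃ p)) ⟩
    suc (suc ℓ) ^ (p * n₃) ∎
    where open ≡-Reasoning

  lower-bound : ∀ {n₁} → (∀ d Q → Separated ℓ pos d Q) → (∀ d → d < p + p → pos d + suc ℓ ≤ n₁) →
    n₃ ≤ suc p → ∀ k → Solvable n₁ (suc p) n₃ k → suc (suc ℓ) ^ (p * n₃) ≤ 2 ^ k
  lower-bound separated fits n₃≤1+p k solvable =
    subst (_≤ 2 ^ k) Φ-layout (Adversary.Solvable⇒Φ≤2^k lo hi (hi≤ fits n₃≤1+p) (admissible separated) k solvable)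

*-+-suc : ∀ m n → m * n + m ≡ m * suc n
*-+-suc m n = trans (+-comm (m * n) m) (sym (*-suc m n))

-- Blocks of length L + 1 starting at multiples of L, consecutive blocks sharing an endpoint.
module _ (L : ℕ) .{{_ : NonZero L}} where

  block-gap : ∀ {d d′} → d < d′ → L * d + L ≤ L * d′
  block-gap {d} d<d′ = ≤-trans (≤-reflexive (*-+-suc L d)) (*-monoʳ-≤ L d<d′)

  block-below-next : ∀ d → L * d < L * d + L
  block-below-next d = m<m+n (L * d) (>-nonZero⁻¹ L)

  blocks-later : ∀ {d Q} → Q < L * d + L → LaterAbove (L *_) d Q
  blocks-later Q<Ld+L d′ d<d′ = <-≤-trans Q<Ld+L (block-gap d<d′)

  blocks-earlier : ∀ {d Q} → L * d < Q → EarlierBelow L (L *_) d Q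
  blocks-earlier Ld<Q d′ d′<d = ≤-<-trans (block-gap d′<d) Ld<Q

  blocks-separated : ∀ d Q → Separated L (L *_) d Q
  blocks-separated d Q with Q ≤? L * d | L * d + L ≤? Q
  ... | yes Q≤Ld | _          = inj₂ (inj₁ (blocks-later (≤-<-trans Q≤Ld (block-below-next d)) , Q≤Ld))
  ... | no  _    | yes Ld+L≤Q = inj₂ (inj₂ (blocks-earlier (<-≤-trans (block-below-next d) Ld+L≤Q) , Ld+L≤Q))
  ... | no  Q≰Ld | no  Ld+L≰Q = inj₁ (blocks-later (≰⇒> Ld+L≰Q) , blocks-earlier (≰⇒> Q≰Ld))

-- Singletons {⌊ d / 2 ⌋}, shared by the diagonals 2m and 2m + 1.
⌊/2⌋-later-or-earlier : ∀ d → LaterAbove ⌊_/2⌋ d ⌊ d /2⌋ ⊎ (∀ d′ → d′ < d → ⌊ d′ /2⌋ < ⌊ d /2⌋)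
⌊/2⌋-later-or-earlier zero = inj₂ λ d′ ()
⌊/2⌋-later-or-earlier (suc zero) = inj₁ later
  where
  later : LaterAbove ⌊_/2⌋ 1 0
  later (suc zero)     (s≤s ())
  later (suc (suc d′)) _ = z<s
⌊/2⌋-later-or-earlier (suc (suc d)) with ⌊/2⌋-later-or-earlier d
... | inj₁ later   = inj₁ λ { (suc (suc d′)) (s≤s (s≤s d<d′)) → s≤s (later d′ d<d′) }
... | inj₂ earlier = inj₂ λ { zero _ → z<s
                            ; (suc zero) _ → z<s
                            ; (suc (suc d′)) (s≤s (s≤s d′<d)) → s≤s (earlier d′ d′<d) }

earlierBelow₀ : ∀ {pos d Q} → (∀ d′ → d′ < d → pos d′ < Q) → EarlierBelow 0 pos d Q
earlierBelow₀ below d′ d′<d = ≤-<-trans (≤-reflexive (+-identityʳ _)) (below d′ d′<d)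

halves-separated : ∀ d Q → Separated 0 ⌊_/2⌋ d Q
halves-separated d Q with <-cmp Q ⌊ d /2⌋
... | tri< Q<⌊d/2⌋ _ _ = inj₂ (inj₁ ((λ d′ d<d′ → <-≤-trans Q<⌊d/2⌋ (⌊n/2⌋-mono (<⇒≤ d<d′))) , <⇒≤ Q<⌊d/2⌋))
... | tri> _ _ ⌊d/2⌋<Q = inj₂ (inj₂ (earlierBelow₀ (λ d′ d′<d → ≤-<-trans (⌊n/2⌋-mono (<⇒≤ d′<d)) ⌊d/2⌋<Q) ,
                                      ≤-trans (≤-reflexive (+-identityʳ _)) (<⇒≤ ⌊d/2⌋<Q)))
... | tri≈ _ refl _ with ⌊/2⌋-later-or-earlier d
...   | inj₁ later   = inj₂ (inj₁ (later , ≤-refl))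
...   | inj₂ earlier = inj₂ (inj₂ (earlierBelow₀ earlier , ≤-reflexive (+-identityʳ _)))

n<m+m⇒⌊n/2⌋<m : ∀ n m → n < m + m → ⌊ n /2⌋ < m
n<m+m⇒⌊n/2⌋<m zero          (suc m) _ = z<s
n<m+m⇒⌊n/2⌋<m (suc zero)    (suc m) _ = z<s
n<m+m⇒⌊n/2⌋<m (suc (suc n)) (suc m) (s≤s n+2≤m+1+m) =
  s≤s (n<m+m⇒⌊n/2⌋<m n m (≤-pred (subst (suc (suc n) ≤_) (+-suc m m) n+2≤m+1+m)))

quotient-bracket : ∀ N B → 0 < B → ∃[ ℓ ] ℓ * B ≤ N × N < suc ℓ * B
quotient-bracket N B@(suc _) _ = N / B , m/n*n≤m N B , (begin-strict
  N                 ≡⟨ m≡m%n+[m/n]*n N B ⟩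
  N % B + N / B * B <⟨ +-monoˡ-< (N / B * B) (m%n<n N B) ⟩
  B + N / B * B     ∎)
  where open ≤-Reasoning

2N≤[ℓ+2]²p : ∀ N p ℓ → N < suc ℓ * (p + p) → 2 * N ≤ suc (suc ℓ) * suc (suc ℓ) * p
2N≤[ℓ+2]²p N p ℓ N<[ℓ+1]2p = begin
  2 * N                               ≤⟨ *-monoʳ-≤ 2 (<⇒≤ N<[ℓ+1]2p) ⟩
  2 * (suc ℓ * (p + p))               ≤⟨ m≤n+m _ (ℓ * ℓ * p) ⟩
  ℓ * ℓ * p + 2 * (suc ℓ * (p + p))   ≡⟨ square ℓ p ⟩
  suc (suc ℓ) * suc (suc ℓ) * p       ∎
  where
  open ≤-Reasoning
  square : ∀ ℓ p → ℓ * ℓ * p + 2 * ((1 + ℓ) * (p + p)) ≡ (2 + ℓ) * (2 + ℓ) * p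
  square = solve-∀

bound-from-potential : ∀ N p m k ℓ → N < suc ℓ * (p + p) → suc (suc ℓ) ^ m ≤ 2 ^ k →
  2 ^ m * N ^ m ≤ 2 ^ (2 * k) * p ^ m
bound-from-potential N p m k ℓ N<[ℓ+1]2p potential = begin
  2 ^ m * N ^ m          ≡⟨ ^-distrib-* 2 N m ⟨
  (2 * N) ^ m            ≤⟨ ^-monoˡ-≤ m (2N≤[ℓ+2]²p N p ℓ N<[ℓ+1]2p) ⟩
  (c * c * p) ^ m        ≡⟨ trans (^-distrib-* (c * c) p m) (cong (_* p ^ m) (^-distrib-* c c m)) ⟩
  c ^ m * c ^ m * p ^ m  ≤⟨ *-monoˡ-≤ (p ^ m) (*-mono-≤ potential potential) ⟩
  2 ^ k * 2 ^ k * p ^ m  ≡⟨ cong (_* p ^ m) (^-distribˡ-+-* 2 k k) ⟨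
  2 ^ (k + k) * p ^ m    ≡⟨ cong (λ e → 2 ^ (k + e) * p ^ m) (+-identityʳ k) ⟨
  2 ^ (2 * k) * p ^ m    ∎
  where
  open ≤-Reasoning
  c = suc (suc ℓ)

-- The block length ℓ + 1 is chosen with ℓ · 2p ≤ N < (ℓ + 1) · 2p; for ℓ = 0 the blocks degenerate
-- to shared singletons.
lower-bound : ∀ N p n₃ → 0 < p → n₃ ≤ suc p → p ≤ N → ∀ k → Solvable (suc N) (suc p) n₃ k →
  2 ^ (p * n₃) * N ^ (p * n₃) ≤ 2 ^ (2 * k) * p ^ (p * n₃)
lower-bound N p n₃ 0<p n₃≤1+p p≤N k solvable with quotient-bracket N (p + p) (≤-trans 0<p (m≤m+n p p))
... | zero , _ , N<2p =
  bound-from-potential N p (p * n₃) k 0 N<2p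
    (DiagonalLayout.lower-bound p n₃ 0 ⌊_/2⌋ halves-separated fits n₃≤1+p k solvable)
  where
  fits : ∀ d → d < p + p → ⌊ d /2⌋ + 1 ≤ suc N
  fits d d<2p = ≤-trans (≤-reflexive (+-comm _ 1)) (≤-trans (n<m+m⇒⌊n/2⌋<m d p d<2p) (≤-trans p≤N (n≤1+n N)))
... | suc ℓ , [ℓ+1]2p≤N , N<[ℓ+2]2p =
  bound-from-potential N p (p * n₃) k (suc ℓ) N<[ℓ+2]2p
    (DiagonalLayout.lower-bound p n₃ (suc ℓ) (suc ℓ *_) (blocks-separated (suc ℓ)) fits n₃≤1+p k solvable)
  where
  fits : ∀ d → d < p + p → suc ℓ * d + suc (suc ℓ) ≤ suc N
  fits d d<2p = ≤-trans (≤-reflexive (+-suc _ (suc ℓ)))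
    (s≤s (≤-trans (≤-reflexive (*-+-suc (suc ℓ) d)) (≤-trans (*-monoʳ-≤ (suc ℓ) d<2p) [ℓ+1]2p≤N)))

theorem2 : (n₁ n₂ n₃ : ℕ) → 2 ≤ n₃ → n₃ ≤ n₂ → n₂ ≤ n₁ →
    (k : ℕ) → Solvable n₁ n₂ n₃ k →
      2 ^ ((n₂ ∸ 1) * n₃) * (n₁ ∸ 1) ^ ((n₂ ∸ 1) * n₃)
        ≤ 2 ^ (2 * k) * (n₂ ∸ 1) ^ ((n₂ ∸ 1) * n₃)
theorem2 (suc N) (suc p) n₃ (s≤s (s≤s _)) n₃≤1+p@(s≤s 1+n≤p) (s≤s p≤N) k solvable =
  lower-bound N p n₃ (≤-trans (s≤s z≤n) 1+n≤p) n₃≤1+p p≤N k solvable
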